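{- Let $\ell$ be an odd prime and $q$ a power of an odd prime with $q\equiv-1\pmod{\ell}$, and let $\zeta$ be a primitive $\ell$-th root of unity in $\mathbb{F}_{q^2}$. Then the polynomial $\mathcal{Q}(X)=(\zeta^{ -1}-\zeta)^{ -1}\big((X-\zeta)^\ell-(X-\zeta^{ -1})^\ell\big)\in\mathbb{F}_q[X]$ is separable. -}

module Defs where

open import Level using (Level; _⊔_) renaming (suc to lsuc)
open import Algebra.Bundles using (CommutativeRing)
open import Data.Nat using (ℕ; zero; suc; _<_)
open import Data.Fin using (Fin)
open import Data.List using (List; []; _∷_)
open import Data.List.Relation.Unary.All using (All)
open import Data.Product using (Σ; ∃; ∃₂; _×_)
open import Relation.Nullary using (¬_)
open import Relation.Binary.PropositionalEquality using (_≡_)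

record Field (c r : Level) : Set (lsuc (c ⊔ r)) where
  field
    commutativeRing : CommutativeRing c r
  open CommutativeRing commutativeRing public
  field
    _⁻¹        : Carrier → Carrier
    1≉0        : ¬ (1# ≈ 0#)
    ⁻¹-inverse : ∀ x → ¬ (x ≈ 0#) → (x * (x ⁻¹)) ≈ 1#

module FieldOps {c r : Level} (F : Field c r) where
  open Field F

  HasCardinality : ℕ → Set (c ⊔ r)
  HasCardinality n =
    Σ (Fin n → Carrier) λ f →
      (∀ i j → f i ≈ f j → i ≡ j) × (∀ x → ∃ λ i → f i ≈ x)

  _^_ : Carrier → ℕ → Carrier
  x ^ zero  = 1#
  x ^ suc n = x * (x ^ n)

  nat : ℕ → Carrier
  nat zero    = 0#
  nat (suc n) = 1# + nat n

  IsPrimitiveRoot : ℕ → Carrier → Set r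
  IsPrimitiveRoot n ζ = (ζ ^ n ≈ 1#) × (∀ j → 0 < j → j < n → ¬ (ζ ^ j ≈ 1#))

  -- the subfield F_q of F (when |F| = q²): fixed points of x ↦ x^q
  InSubfield : ℕ → Carrier → Set r
  InSubfield q x = (x ^ q) ≈ x

  -- Polynomials over F: coefficient lists, lowest degree first.
  Poly : Set c
  Poly = List Carrier

  coeff : Poly → ℕ → Carrier
  coeff []      _       = 0#
  coeff (a ∷ p) zero    = a
  coeff (a ∷ p) (suc i) = coeff p i

  -- equality of polynomials (coefficientwise, trailing zeros irrelevant)
  _≈ₚ_ : Poly → Poly → Set r
  p ≈ₚ q = ∀ i → coeff p i ≈ coeff q i

  _+ₚ_ : Poly → Poly → Poly
  []      +ₚ q       = q
  (a ∷ p) +ₚ []      = a ∷ p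
  (a ∷ p) +ₚ (b ∷ q) = (a + b) ∷ (p +ₚ q)

  _·ₚ_ : Carrier → Poly → Poly
  a ·ₚ []      = []
  a ·ₚ (b ∷ p) = (a * b) ∷ (a ·ₚ p)

  -ₚ_ : Poly → Poly
  -ₚ p = (- 1#) ·ₚ p

  _*ₚ_ : Poly → Poly → Poly
  []      *ₚ q = []
  (a ∷ p) *ₚ q = (a ·ₚ q) +ₚ (0# ∷ (p *ₚ q))

  _^ₚ_ : Poly → ℕ → Poly
  p ^ₚ zero  = 1# ∷ []
  p ^ₚ suc n = p *ₚ (p ^ₚ n)

  X-_ : Carrier → Poly
  X- a = (- a) ∷ 1# ∷ []

  derivFrom : ℕ → Poly → Poly
  derivFrom k []      = []
  derivFrom k (a ∷ p) = (nat k * a) ∷ derivFrom (suc k) p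

  deriv : Poly → Poly
  deriv []      = []
  deriv (a ∷ p) = derivFrom 1 p

  -- separable: coprime to its formal derivative, i.e. gcd(f, f') = 1
  IsSeparable : Poly → Set (c ⊔ r)
  IsSeparable f = ∃₂ λ u v → ((u *ₚ f) +ₚ (v *ₚ deriv f)) ≈ₚ (1# ∷ [])

  𝒬 : ℕ → Carrier → Poly
  𝒬 l ζ = (((ζ ⁻¹) - ζ) ⁻¹) ·ₚ (((X- ζ) ^ₚ l) +ₚ (-ₚ ((X- (ζ ⁻¹)) ^ₚ l)))

module Submission where

-- Write A = X − ζ and B = X − ζ⁻¹, so that 𝒬 = k(Aˡ − Bˡ) with k = (ζ⁻¹ − ζ)⁻¹ and k(A − B) = 1.
-- Then 𝒬′ = kℓ(Aˡ⁻¹ − Bˡ⁻¹). As A and B are coprime, so are their powers, and a Bézout relation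
-- sAˡ⁻¹ + tBˡ⁻¹ = 1 gives (s + t)𝒬 − (sB + tA)ℓ⁻¹𝒬′ = k(A − B)(sAˡ⁻¹ + tBˡ⁻¹) = 1. This needs
-- ℓ ≠ 0 in F, which holds because ℓ ∣ q + 1 while q = 0 in F.
-- A field with q² elements has characteristic p, so x ↦ x^q is a ring endomorphism of F. As
-- ζ^(q+1) = 1 it exchanges ζ and ζ⁻¹, and 𝒬 is symmetric in ζ and ζ⁻¹, so it fixes 𝒬: the
-- coefficients of 𝒬 lie in 𝔽_q.

open import Level using (Level)
open import Function using (id; _∘_)
open import Data.Empty using (⊥-elim)
open import Data.Sum using (inj₁; inj₂; [_,_]′)
open import Data.Product using (∃₂; _,_; proj₁; proj₂)
open import Data.Maybe using (Maybe; just; nothing)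
open import Data.Nat using (ℕ; zero; suc; _∸_; nonTrivial⇒n>1)
import Data.Nat as ℕ
import Data.Nat.Properties as ℕ
open import Data.Nat.Divisibility using (_∣_; divides; ∣-refl; ∣1⇒≡1; ∣⇒≤; m∣m*n)
open import Data.Nat.Primality using (Prime; prime; euclidsLemma; prime⇒nonTrivial)
open import Data.Nat.Combinatorics using (_C_; nCn≡1; k![n∸k]!∣n!)
open import Data.Nat.Combinatorics.Specification using (nCk≡n!/k![n-k]!)
open import Data.Nat.DivMod using (m/n*n≡m)
import Data.Integer as ℤ
import Data.Integer.Properties as ℤ
import Data.Sign as Sign
open import Data.Fin using (Fin; zero; suc; inject₁; fromℕ)
import Data.Fin.Properties as Fin
open import Data.Fin.Permutation using (Permutation; permutation)
open import Data.List using ([]; _∷_)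
import Data.List as List
open import Data.List.Relation.Unary.All using (All; []; _∷_)
import Data.List.Relation.Unary.All as All
open import Relation.Nullary using (¬_; yes; no)
open import Relation.Nullary.Decidable using (decidable-stable)
import Relation.Nullary.Decidable as Dec
open import Relation.Binary.Definitions using (Decidable)
open import Relation.Binary.Bundles using (Setoid)
open import Relation.Binary.PropositionalEquality as ≡ using (_≡_)
import Relation.Binary.Reasoning.Setoid as SetoidReasoning
open import Algebra.Bundles using (CommutativeRing)
open import Algebra.Morphism.Structures using (IsRingHomomorphism)
import Algebra.Properties.Ring as RingProperties
import Algebra.Properties.Semiring.Mult as SemiringMult
open import Algebra.Solver.Ring.AlmostCommutativeRing
  using (fromCommutativeRing; _-Raw-AlmostCommutative⟶_)
import Algebra.Solver.Ring as RingSolver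

open import Defs

prime∤! : ∀ {p} → Prime p → ∀ m → m ℕ.< p → ¬ p ∣ m ℕ.!
prime∤! p-prime zero m<p p∣1 with ∣1⇒≡1 p∣1
prime∤! (prime {{()}} _) zero m<p p∣1 | ≡.refl
prime∤! p-prime (suc m) m<p p∣m! with euclidsLemma (suc m) (m ℕ.!) p-prime p∣m!
... | inj₁ p∣1+m = ℕ.<⇒≱ m<p (∣⇒≤ p∣1+m)
... | inj₂ p∣m!  = prime∤! p-prime m (ℕ.<-trans (ℕ.n<1+n m) m<p) p∣m!

m∣m^n : ∀ m {n} → n ℕ.≥ 1 → m ∣ m ℕ.^ n
m∣m^n m {suc n} _ = m∣m*n (m ℕ.^ n)

odd-prime⇒2< : ∀ {l} → Prime l → ¬ 2 ∣ l → 2 ℕ.< l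
odd-prime⇒2< {l} l-prime 2∤l = ℕ.≤∧≢⇒< (nonTrivial⇒n>1 l {{prime⇒nonTrivial l-prime}})
  (λ 2≡l → 2∤l (≡.subst (2 ∣_) 2≡l ∣-refl))

C*k!*[n-k]!≡n! : ∀ {n k} → k ℕ.≤ n → (n C k) ℕ.* (k ℕ.! ℕ.* (n ∸ k) ℕ.!) ≡ n ℕ.!
C*k!*[n-k]!≡n! {n} {k} k≤n =
  ≡.trans (≡.cong (ℕ._* (k ℕ.! ℕ.* (n ∸ k) ℕ.!)) (nCk≡n!/k![n-k]! k≤n))
          (m/n*n≡m (k![n∸k]!∣n! k≤n))
  where instance _ = ℕ._!*_!≢0 k (n ∸ k)

-- p divides p! = C(p, k) · k! · (p − k)! but neither k! nor (p − k)!.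
prime∣C : ∀ {p k} → Prime p → 0 ℕ.< k → k ℕ.< p → p ∣ p C k
prime∣C {suc p′} {k} p-prime 0<k k<p =
  [ id , ⊥-elim ∘ [ prime∤! p-prime k k<p , prime∤! p-prime (p ∸ k) p-k<p ]′ ∘ euclidsLemma _ _ p-prime ]′
    (euclidsLemma (p C k) _ p-prime p∣C*k!*[p-k]!)
  where
  p = suc p′
  p-k<p : p ∸ k ℕ.< p
  p-k<p = ℕ.∸-monoʳ-< {o = 0} 0<k (ℕ.<⇒≤ k<p)
  p∣C*k!*[p-k]! : p ∣ (p C k) ℕ.* (k ℕ.! ℕ.* (p ∸ k) ℕ.!)
  p∣C*k!*[p-k]! = ≡.subst (p ∣_) (≡.sym (C*k!*[n-k]!≡n! (ℕ.<⇒≤ k<p))) (m∣m*n (p′ ℕ.!))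

-- With the ring itself as coefficient domain the solver cannot normalise x − x to 0 (that
-- would need decidable equality), so the coefficients are taken from ℤ.
module IntegerCoefficientSolver {c r : Level} (R : CommutativeRing c r) where
  open import Data.Integer using (ℤ; +_; -[1+_]; _⊖_)
  open CommutativeRing R
  open RingProperties ring
  open SemiringMult semiring using (_×_; ×-homo-+; ×1-homo-*)
  open SetoidReasoning setoid

  ⟦_⟧ : ℤ → Carrier
  ⟦ + n ⟧      = n × 1#
  ⟦ -[1+ n ] ⟧ = - (suc n × 1#)

  private
    signed : Sign.Sign → Carrier → Carrier
    signed Sign.+ x = x
    signed Sign.- x = - x

    signed-cong : ∀ s {x y} → x ≈ y → signed s x ≈ signed s y
    signed-cong Sign.+ x≈y = x≈y
    signed-cong Sign.- x≈y = -‿cong x≈y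

    signed-* : ∀ s t x y → signed (s Sign.* t) (x * y) ≈ signed s x * signed t y
    signed-* Sign.+ Sign.+ x y = refl
    signed-* Sign.+ Sign.- x y = -‿distribʳ-* x y
    signed-* Sign.- Sign.+ x y = -‿distribˡ-* x y
    signed-* Sign.- Sign.- x y = begin
      x * y           ≈⟨ -‿involutive (x * y) ⟨
      - - (x * y)     ≈⟨ -‿cong (-‿distribˡ-* x y) ⟩
      - (- x * y)     ≈⟨ -‿distribʳ-* (- x) y ⟩
      - x * - y       ∎

    ⟦◃⟧ : ∀ s n → ⟦ s ℤ.◃ n ⟧ ≈ signed s (n × 1#)
    ⟦◃⟧ Sign.+ zero    = refl
    ⟦◃⟧ Sign.- zero    = sym -0#≈0#
    ⟦◃⟧ Sign.+ (suc n) = refl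
    ⟦◃⟧ Sign.- (suc n) = refl

    ⟦signAbs⟧ : ∀ i → ⟦ i ⟧ ≈ signed (ℤ.sign i) (ℤ.∣ i ∣ × 1#)
    ⟦signAbs⟧ (+ n)      = refl
    ⟦signAbs⟧ -[1+ n ]   = refl

    1+x-[1+y]≈x-y : ∀ x y → (1# + x) - (1# + y) ≈ x - y
    1+x-[1+y]≈x-y x y = begin
      (1# + x) - (1# + y)        ≈⟨ +-congˡ (-‿anti-homo-+ 1# y) ⟩
      (1# + x) + (- y - 1#)      ≈⟨ +-congʳ (+-comm 1# x) ⟩
      (x + 1#) + (- y - 1#)      ≈⟨ +-assoc x 1# _ ⟩
      x + (1# + (- y - 1#))      ≈⟨ +-congˡ (+-comm 1# _) ⟩
      x + ((- y - 1#) + 1#)      ≈⟨ +-congˡ (+-assoc (- y) (- 1#) 1#) ⟩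
      x + (- y + (- 1# + 1#))    ≈⟨ +-congˡ (+-congˡ (-‿inverseˡ 1#)) ⟩
      x + (- y + 0#)             ≈⟨ +-congˡ (+-identityʳ (- y)) ⟩
      x - y                      ∎

    ⟦⊖⟧ : ∀ m n → ⟦ m ⊖ n ⟧ ≈ m × 1# - n × 1#
    ⟦⊖⟧ zero    zero    = sym (-‿inverseʳ 0#)
    ⟦⊖⟧ zero    (suc n) = sym (+-identityˡ _)
    ⟦⊖⟧ (suc m) zero    = sym (trans (+-congˡ -0#≈0#) (+-identityʳ _))
    ⟦⊖⟧ (suc m) (suc n) = begin
      ⟦ suc m ⊖ suc n ⟧          ≡⟨ ≡.cong ⟦_⟧ (ℤ.[1+m]⊖[1+n]≡m⊖n m n) ⟩
      ⟦ m ⊖ n ⟧                  ≈⟨ ⟦⊖⟧ m n ⟩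
      m × 1# - n × 1#            ≈⟨ 1+x-[1+y]≈x-y _ _ ⟨
      suc m × 1# - suc n × 1#    ∎

  ⟦⟧-+ : ∀ i j → ⟦ i ℤ.+ j ⟧ ≈ ⟦ i ⟧ + ⟦ j ⟧
  ⟦⟧-+ (+ m)      (+ n)      = ×-homo-+ 1# m n
  ⟦⟧-+ (+ m)      -[1+ n ]   = ⟦⊖⟧ m (suc n)
  ⟦⟧-+ -[1+ m ]   (+ n)      = trans (⟦⊖⟧ n (suc m)) (+-comm _ _)
  ⟦⟧-+ -[1+ m ]   -[1+ n ]   = begin
    - (suc (suc m ℕ.+ n) × 1#)            ≡⟨ ≡.cong (λ k → - (suc k × 1#)) (ℕ.+-suc m n) ⟨
    - ((suc m ℕ.+ suc n) × 1#)            ≈⟨ -‿cong (×-homo-+ 1# (suc m) (suc n)) ⟩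
    - (suc m × 1# + suc n × 1#)           ≈⟨ -‿+-comm _ _ ⟨
    - (suc m × 1#) + - (suc n × 1#)       ∎

  ⟦⟧-* : ∀ i j → ⟦ i ℤ.* j ⟧ ≈ ⟦ i ⟧ * ⟦ j ⟧
  ⟦⟧-* i j = begin
    ⟦ i ℤ.* j ⟧                                   ≈⟨ ⟦◃⟧ s (ℤ.∣ i ∣ ℕ.* ℤ.∣ j ∣) ⟩
    signed s ((ℤ.∣ i ∣ ℕ.* ℤ.∣ j ∣) × 1#)         ≈⟨ signed-cong s (×1-homo-* ℤ.∣ i ∣ ℤ.∣ j ∣) ⟩
    signed s (ℤ.∣ i ∣ × 1# * ℤ.∣ j ∣ × 1#)        ≈⟨ signed-* (ℤ.sign i) (ℤ.sign j) _ _ ⟩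
    signed (ℤ.sign i) (ℤ.∣ i ∣ × 1#) * signed (ℤ.sign j) (ℤ.∣ j ∣ × 1#)
                                                  ≈⟨ *-cong (⟦signAbs⟧ i) (⟦signAbs⟧ j) ⟨
    ⟦ i ⟧ * ⟦ j ⟧                                 ∎
    where s = ℤ.sign i Sign.* ℤ.sign j

  ⟦⟧-neg : ∀ i → ⟦ ℤ.- i ⟧ ≈ - ⟦ i ⟧
  ⟦⟧-neg (+ zero)    = sym -0#≈0#
  ⟦⟧-neg (+ suc n)   = refl
  ⟦⟧-neg -[1+ n ]    = sym (-‿involutive _)

  private
    morphism : ℤ.+-*-rawRing -Raw-AlmostCommutative⟶ fromCommutativeRing R
    morphism = record
      { ⟦_⟧    = ⟦_⟧
      ; +-homo = ⟦⟧-+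
      ; *-homo = ⟦⟧-*
      ; -‿homo = ⟦⟧-neg
      ; 0-homo = refl
      ; 1-homo = +-identityʳ 1#
      }

    _≟⟦⟧_ : ∀ i j → Maybe (⟦ i ⟧ ≈ ⟦ j ⟧)
    i ≟⟦⟧ j with i ℤ.≟ j
    ... | yes ≡.refl = just refl
    ... | no _       = nothing

  open RingSolver ℤ.+-*-rawRing (fromCommutativeRing R) morphism _≟⟦⟧_ public
    using (solve; _:+_; _:*_; :-_; _:-_; _:=_)

module CoprimeElements {c r : Level} (R : CommutativeRing c r) where
  open CommutativeRing R
  open IntegerCoefficientSolver R
  open RingProperties ring using (x≈y⇒x∙y⁻¹≈ε)
  open import Algebra.Properties.Semiring.Exp semiring using (_^_)
  open SetoidReasoning setoid

  Coprime : Carrier → Carrier → Set (c Level.⊔ r)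
  Coprime x y = ∃₂ λ s t → s * x + t * y ≈ 1#

  coprime-sym : ∀ {x y} → Coprime x y → Coprime y x
  coprime-sym (s , t , eq) = t , s , trans (+-comm _ _) eq

  coprime-*ˡ : ∀ {x x′ y} → Coprime x y → Coprime x′ y → Coprime (x * x′) y
  coprime-*ˡ {x} {x′} {y} (s , t , eq) (s′ , t′ , eq′) =
    s * s′ , s * x * t′ + t * (s′ * x′ + t′ * y) , (begin
      s * s′ * (x * x′) + (s * x * t′ + t * (s′ * x′ + t′ * y)) * y
        ≈⟨ solve 7 (λ s t s′ t′ x x′ y →
             s :* s′ :* (x :* x′) :+ (s :* x :* t′ :+ t :* (s′ :* x′ :+ t′ :* y)) :* y
             := (s :* x :+ t :* y) :* (s′ :* x′ :+ t′ :* y)) refl s t s′ t′ x x′ y ⟩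
      (s * x + t * y) * (s′ * x′ + t′ * y)  ≈⟨ *-cong eq eq′ ⟩
      1# * 1#                               ≈⟨ *-identityˡ 1# ⟩
      1#                                    ∎)

  coprime-^ˡ : ∀ {x y} → Coprime x y → ∀ m → Coprime (x ^ m) y
  coprime-^ˡ {y = y} _ zero = 1# , 0# , trans (+-cong (*-identityˡ 1#) (zeroˡ y)) (+-identityʳ 1#)
  coprime-^ˡ x⊥y (suc m) = coprime-*ˡ x⊥y (coprime-^ˡ x⊥y m)

  coprime-^ : ∀ {x y} → Coprime x y → ∀ m n → Coprime (x ^ m) (y ^ n)
  coprime-^ x⊥y m n = coprime-sym (coprime-^ˡ (coprime-sym (coprime-^ˡ x⊥y m)) n)

  powerDifferences-coprime : ∀ {k a b μ μ′} n → k * (a - b) ≈ 1# → μ′ * μ ≈ 1# →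
    Coprime (k * (a ^ suc n - b ^ suc n)) (k * (μ * (a ^ n - b ^ n)))
  powerDifferences-coprime {k} {a} {b} {μ} {μ′} n k[a-b]≈1 μ′μ≈1 =
    combine (coprime-^ a⊥b n n)
    where
    a⊥b : Coprime a b
    a⊥b = k , - k , trans (solve 3 (λ k a b → k :* a :+ :- k :* b := k :* (a :- b)) refl k a b)
                          k[a-b]≈1
    combine : Coprime (a ^ n) (b ^ n) →
              Coprime (k * (a ^ suc n - b ^ suc n)) (k * (μ * (a ^ n - b ^ n)))
    combine (s , t , eq) = s + t , - ((s * b + t * a) * μ′) , (begin
      (s + t) * (k * (a * a ^ n - b * b ^ n))
        + - ((s * b + t * a) * μ′) * (k * (μ * (a ^ n - b ^ n)))
        ≈⟨ solve 9 (λ s t k a b aⁿ bⁿ μ μ′ →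
             (s :+ t) :* (k :* (a :* aⁿ :- b :* bⁿ))
               :+ :- ((s :* b :+ t :* a) :* μ′) :* (k :* (μ :* (aⁿ :- bⁿ)))
             := k :* (a :- b) :* (s :* aⁿ :+ t :* bⁿ)
                :+ ((s :* b :+ t :* a) :* k :* (aⁿ :- bⁿ)
                    :- (s :* b :+ t :* a) :* k :* (aⁿ :- bⁿ) :* (μ′ :* μ)))
             refl s t k a b (a ^ n) (b ^ n) μ μ′ ⟩
      k * (a - b) * (s * a ^ n + t * b ^ n) + (w - w * (μ′ * μ))
        ≈⟨ +-cong (*-cong k[a-b]≈1 eq) (x≈y⇒x∙y⁻¹≈ε w≈wμ′μ) ⟩
      1# * 1# + 0#       ≈⟨ +-congʳ (*-identityˡ 1#) ⟩
      1# + 0#            ≈⟨ +-identityʳ 1# ⟩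
      1#                 ∎)
      where
      w = (s * b + t * a) * k * (a ^ n - b ^ n)
      w≈wμ′μ : w ≈ w * (μ′ * μ)
      w≈wμ′μ = trans (sym (*-identityʳ w)) (*-congˡ (sym μ′μ≈1))

module CommutativeRingProperties {c r : Level} (R : CommutativeRing c r) where
  open CommutativeRing R hiding (zero)
  open import Algebra.Properties.CommutativeSemiring.Exp commutativeSemiring
    using (_^_; ^-congˡ; ^-assocʳ; ^-distrib-*)
  open RingProperties ring using (x+x≈x⇒x≈0; +-inverseʳ-unique)
  open import Algebra.Properties.CommutativeSemiring.Binomial commutativeSemiring
    using (theorem; binomialTerm)
  open SemiringMult semiring using (_×_; ×-congʳ; ×-assoc-*; ×-assocˡ; ×-homo-1; ×1-homo-*)
  open import Algebra.Properties.Monoid.Sum +-monoid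
    using (sum; sum-init-last; sum-cong-≋; sum-replicate-zero)
  open SetoidReasoning setoid

  1^n≈1 : ∀ n → 1# ^ n ≈ 1#
  1^n≈1 zero    = refl
  1^n≈1 (suc n) = trans (*-identityˡ (1# ^ n)) (1^n≈1 n)

  ∣⇒^≈1 : ∀ {x l n} → x ^ l ≈ 1# → l ∣ n → x ^ n ≈ 1#
  ∣⇒^≈1 {x} {l} {n} xˡ≈1 (divides m n≡m*l) = begin
    x ^ n           ≡⟨ ≡.cong (x ^_) (≡.trans n≡m*l (ℕ.*-comm m l)) ⟩
    x ^ (l ℕ.* m)   ≈⟨ ^-assocʳ x l m ⟨
    (x ^ l) ^ m     ≈⟨ ^-congˡ m xˡ≈1 ⟩
    1# ^ m          ≈⟨ 1^n≈1 m ⟩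
    1#              ∎

  ×1-homo-^ : ∀ m n → (m ℕ.^ n) × 1# ≈ (m × 1#) ^ n
  ×1-homo-^ m zero    = +-identityʳ 1#
  ×1-homo-^ m (suc n) = trans (×1-homo-* m (m ℕ.^ n)) (*-congˡ (×1-homo-^ m n))

  ∣⇒×1≈0 : ∀ {m n} → m ∣ n → m × 1# ≈ 0# → n × 1# ≈ 0#
  ∣⇒×1≈0 {m} {n} (divides k n≡k*m) m×1≈0 = begin
    n × 1#               ≡⟨ ≡.cong (_× 1#) n≡k*m ⟩
    (k ℕ.* m) × 1#       ≈⟨ ×1-homo-* k m ⟩
    k × 1# * m × 1#      ≈⟨ *-congˡ m×1≈0 ⟩
    k × 1# * 0#          ≈⟨ zeroʳ _ ⟩
    0#                   ∎

  ×1≈0⇒×≈0 : ∀ {p} → p × 1# ≈ 0# → ∀ z → p × z ≈ 0#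
  ×1≈0⇒×≈0 {p} p×1≈0 z = begin
    p × z         ≈⟨ ×-congʳ p (*-identityˡ z) ⟨
    p × (1# * z)  ≈⟨ ×-assoc-* p 1# z ⟨
    p × 1# * z    ≈⟨ *-congʳ p×1≈0 ⟩
    0# * z        ≈⟨ zeroˡ z ⟩
    0#            ∎

  C×≈0 : ∀ {p k} → Prime p → p × 1# ≈ 0# → 0 ℕ.< k → k ℕ.< p → ∀ z → (p C k) × z ≈ 0#
  C×≈0 {p} {k} p-prime p×1≈0 0<k k<p z with prime∣C p-prime 0<k k<p
  ... | divides m pCk≡m*p = begin
    (p C k) × z     ≡⟨ ≡.cong (_× z) (≡.trans pCk≡m*p (ℕ.*-comm m p)) ⟩
    (p ℕ.* m) × z   ≈⟨ ×-assocˡ z p m ⟨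
    p × (m × z)     ≈⟨ ×1≈0⇒×≈0 {p} p×1≈0 (m × z) ⟩
    0#              ∎

  freshmansDream : ∀ {p} → Prime p → p × 1# ≈ 0# → ∀ x y → (x + y) ^ p ≈ x ^ p + y ^ p
  freshmansDream {suc p′} p-prime p×1≈0 x y = begin
    (x + y) ^ p                                      ≈⟨ theorem p x y ⟩
    T zero + sum (T ∘ suc)                           ≈⟨ +-congˡ (sum-init-last (T ∘ suc)) ⟩
    T zero + (sum (T ∘ suc ∘ inject₁) + T (suc (fromℕ p′)))
      ≈⟨ +-cong (T₀≈yᵖ) (+-cong (sum-cong-≋ Tᵢ≈0) Tₚ≈xᵖ) ⟩
    y ^ p + (sum {p′} (λ _ → 0#) + x ^ p)            ≈⟨ +-congˡ (+-congʳ (sum-replicate-zero p′)) ⟩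
    y ^ p + (0# + x ^ p)                             ≈⟨ +-congˡ (+-identityˡ (x ^ p)) ⟩
    y ^ p + x ^ p                                    ≈⟨ +-comm (y ^ p) (x ^ p) ⟩
    x ^ p + y ^ p                                    ∎
    where
    p = suc p′
    T = binomialTerm x y p
    T₀≈yᵖ : T zero ≈ y ^ p
    T₀≈yᵖ = trans (×-homo-1 _) (*-identityˡ (y ^ p))
    Tᵢ≈0 : ∀ i → T (suc (inject₁ i)) ≈ 0#
    Tᵢ≈0 i = C×≈0 p-prime p×1≈0 (ℕ.s≤s ℕ.z≤n)
      (ℕ.s≤s (≡.subst (ℕ._< p′) (≡.sym (Fin.toℕ-inject₁ i)) (Fin.toℕ<n i))) _
    Tₚ≈xᵖ : T (suc (fromℕ p′)) ≈ x ^ p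
    Tₚ≈xᵖ rewrite Fin.toℕ-fromℕ p′ | nCn≡1 p | ℕ.n∸n≡0 p =
      trans (×-homo-1 _) (*-identityʳ (x ^ p))

  freshmansDream-^ : ∀ {p} → Prime p → p × 1# ≈ 0# →
    ∀ k x y → (x + y) ^ (p ℕ.^ k) ≈ x ^ (p ℕ.^ k) + y ^ (p ℕ.^ k)
  freshmansDream-^ p-prime p×1≈0 zero    x y = distribʳ 1# x y
  freshmansDream-^ {p} p-prime p×1≈0 (suc k) x y = begin
    (x + y) ^ (p ℕ.* p ℕ.^ k)                    ≈⟨ ^-assocʳ (x + y) p (p ℕ.^ k) ⟨
    ((x + y) ^ p) ^ (p ℕ.^ k)                    ≈⟨ ^-congˡ (p ℕ.^ k) (freshmansDream p-prime p×1≈0 x y) ⟩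
    (x ^ p + y ^ p) ^ (p ℕ.^ k)                  ≈⟨ freshmansDream-^ p-prime p×1≈0 k (x ^ p) (y ^ p) ⟩
    (x ^ p) ^ (p ℕ.^ k) + (y ^ p) ^ (p ℕ.^ k)    ≈⟨ +-cong (^-assocʳ x p (p ℕ.^ k)) (^-assocʳ y p (p ℕ.^ k)) ⟩
    x ^ (p ℕ.* p ℕ.^ k) + y ^ (p ℕ.* p ℕ.^ k)    ∎

  ^-isRingHomomorphism : ∀ {n} → (∀ x y → (x + y) ^ n ≈ x ^ n + y ^ n) →
    IsRingHomomorphism rawRing rawRing (_^ n)
  ^-isRingHomomorphism {n} additive = record
    { isSemiringHomomorphism = record
      { isNearSemiringHomomorphism = record
        { +-isMonoidHomomorphism = record
          { isMagmaHomomorphism = record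
            { isRelHomomorphism = record { cong = ^-congˡ n }
            ; homo = additive
            }
          ; ε-homo = 0ⁿ≈0
          }
        ; *-homo = λ x y → ^-distrib-* x y n
        }
      ; 1#-homo = 1^n≈1 n
      }
    ; -‿homo = λ x → +-inverseʳ-unique (x ^ n) ((- x) ^ n) (begin
        x ^ n + (- x) ^ n  ≈⟨ additive x (- x) ⟨
        (x - x) ^ n        ≈⟨ ^-congˡ n (-‿inverseʳ x) ⟩
        0# ^ n             ≈⟨ 0ⁿ≈0 ⟩
        0#                 ∎)
    }
    where
    0ⁿ≈0 : 0# ^ n ≈ 0#
    0ⁿ≈0 = x+x≈x⇒x≈0 (0# ^ n) (trans (sym (additive 0# 0#)) (^-congˡ n (+-identityʳ 0#)))

module FieldProperties {c r : Level} (F : Field c r) where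
  open Field F
  open import Algebra.Properties.Semiring.Exp semiring using (_^_)
  open SemiringMult semiring using (_×_)
  open CommutativeRingProperties commutativeRing using (∣⇒×1≈0)
  open SetoidReasoning setoid

  ^ᶠ≡^ : ∀ x n → FieldOps._^_ F x n ≡ x ^ n
  ^ᶠ≡^ x zero    = ≡.refl
  ^ᶠ≡^ x (suc n) = ≡.cong (x *_) (^ᶠ≡^ x n)

  nat≡×1 : ∀ n → FieldOps.nat F n ≡ n × 1#
  nat≡×1 zero    = ≡.refl
  nat≡×1 (suc n) = ≡.cong (1# +_) (nat≡×1 n)

  ∣suc⇒×1≉0 : ∀ {m n} → n × 1# ≈ 0# → m ∣ suc n → ¬ m × 1# ≈ 0#
  ∣suc⇒×1≉0 {n = n} n×1≈0 m∣1+n m×1≈0 = 1≉0 (begin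
    1#            ≈⟨ +-identityʳ 1# ⟨
    1# + 0#       ≈⟨ +-congˡ n×1≈0 ⟨
    suc n × 1#    ≈⟨ ∣⇒×1≈0 m∣1+n m×1≈0 ⟩
    0#            ∎)

  *≈1⇒≉0 : ∀ {x y} → x * y ≈ 1# → ¬ x ≈ 0#
  *≈1⇒≉0 {x} {y} xy≈1 x≈0 = 1≉0 (begin
    1#      ≈⟨ xy≈1 ⟨
    x * y   ≈⟨ *-congʳ x≈0 ⟩
    0# * y  ≈⟨ zeroˡ y ⟩
    0#      ∎)

  inverse-unique : ∀ {x y z} → x * y ≈ 1# → x * z ≈ 1# → y ≈ z
  inverse-unique {x} {y} {z} xy≈1 xz≈1 = begin
    y            ≈⟨ *-identityʳ y ⟨
    y * 1#       ≈⟨ *-congˡ xz≈1 ⟨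
    y * (x * z)  ≈⟨ *-assoc y x z ⟨
    y * x * z    ≈⟨ *-congʳ (trans (*-comm y x) xy≈1) ⟩
    1# * z       ≈⟨ *-identityˡ z ⟩
    z            ∎

  ⁻¹-unique : ∀ {x y} → x * y ≈ 1# → y ≈ x ⁻¹
  ⁻¹-unique {x} xy≈1 = inverse-unique xy≈1 (⁻¹-inverse x (*≈1⇒≉0 xy≈1))

  ⁻¹-cong : ∀ {x y} → ¬ x ≈ 0# → x ≈ y → x ⁻¹ ≈ y ⁻¹
  ⁻¹-cong {x} x≉0 x≈y = ⁻¹-unique (trans (*-congʳ (sym x≈y)) (⁻¹-inverse x x≉0))

  ^≉0 : ∀ {x} → ¬ x ≈ 0# → ∀ n → ¬ x ^ n ≈ 0#
  ^≉0 x≉0 zero    = 1≉0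
  ^≉0 {x} x≉0 (suc n) xxⁿ≈0 = ^≉0 x≉0 n (begin
    x ^ n                ≈⟨ *-identityˡ (x ^ n) ⟨
    1# * x ^ n           ≈⟨ *-congʳ (trans (*-comm _ _) (⁻¹-inverse x x≉0)) ⟨
    x ⁻¹ * x * x ^ n     ≈⟨ *-assoc (x ⁻¹) x (x ^ n) ⟩
    x ⁻¹ * (x * x ^ n)   ≈⟨ *-congˡ xxⁿ≈0 ⟩
    x ⁻¹ * 0#            ≈⟨ zeroʳ (x ⁻¹) ⟩
    0#                   ∎)

  ^≈0⇒≈0 : Decidable _≈_ → ∀ {x} n → x ^ n ≈ 0# → x ≈ 0#
  ^≈0⇒≈0 _≟_ {x} n xⁿ≈0 = decidable-stable (x ≟ 0#) (λ x≉0 → ^≉0 x≉0 n xⁿ≈0)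

module FieldHomomorphism {c r : Level} (F : Field c r) {φ : Field.Carrier F → Field.Carrier F}
  (φ-isRingHomomorphism : IsRingHomomorphism (Field.rawRing F) (Field.rawRing F) φ) where
  open Field F
  open IsRingHomomorphism φ-isRingHomomorphism
  open FieldProperties F
  open SetoidReasoning setoid

  -homo : ∀ x y → φ (x - y) ≈ φ x - φ y
  -homo x y = trans (+-homo x (- y)) (+-congˡ (-‿homo y))

  φ-inverse : ∀ {x} → ¬ x ≈ 0# → φ x * φ (x ⁻¹) ≈ 1#
  φ-inverse {x} x≉0 = begin
    φ x * φ (x ⁻¹)  ≈⟨ *-homo x (x ⁻¹) ⟨
    φ (x * x ⁻¹)    ≈⟨ ⟦⟧-cong (⁻¹-inverse x x≉0) ⟩
    φ 1#            ≈⟨ 1#-homo ⟩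
    1#              ∎

  ⁻¹-homo : ∀ {x} → ¬ x ≈ 0# → φ (x ⁻¹) ≈ φ x ⁻¹
  ⁻¹-homo x≉0 = ⁻¹-unique (φ-inverse x≉0)

  φ≉0 : ∀ {x} → ¬ x ≈ 0# → ¬ φ x ≈ 0#
  φ≉0 x≉0 = *≈1⇒≉0 (φ-inverse x≉0)

  ⁻¹-swap : ∀ {x} → ¬ x ≈ 0# → φ x ≈ x ⁻¹ → φ (x ⁻¹) ≈ x
  ⁻¹-swap {x} x≉0 φx≈x⁻¹ = inverse-unique (trans (*-congʳ (sym φx≈x⁻¹)) (φ-inverse x≉0))
    (trans (*-comm (x ⁻¹) x) (⁻¹-inverse x x≉0))

module FiniteField {c r : Level} (F : Field c r) {Q : ℕ} (card : FieldOps.HasCardinality F Q) where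
  open Field F
  open RingProperties ring using (+-cancelˡ)
  open SemiringMult semiring using (_×_)
  open import Algebra.Properties.Semiring.Exp semiring using (_^_)
  open CommutativeRingProperties commutativeRing using (×1-homo-^)
  open FieldProperties F using (^≈0⇒≈0)
  open import Algebra.Properties.CommutativeMonoid.Sum +-commutativeMonoid
    using (sum; sum-permute; ∑-distrib-+; sum-cong-≋; sum-replicate)
  open SetoidReasoning setoid

  private
    enum : Fin Q → Carrier
    enum = proj₁ card

    enum-injective : ∀ i j → enum i ≈ enum j → i ≡ j
    enum-injective = proj₁ (proj₂ card)

    index : Carrier → Fin Q
    index x = proj₁ (proj₂ (proj₂ card) x)

    enum-index : ∀ x → enum (index x) ≈ x
    enum-index x = proj₂ (proj₂ (proj₂ card) x)

  _≟_ : Decidable _≈_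
  x ≟ y = Dec.map′
    (λ i≡j → trans (sym (enum-index x)) (trans (reflexive (≡.cong enum i≡j)) (enum-index y)))
    (λ x≈y → enum-injective _ _ (trans (enum-index x) (trans x≈y (sym (enum-index y)))))
    (index x Fin.≟ index y)

  private
    shift : Carrier → Fin Q → Fin Q
    shift a i = index (enum i + a)

    shift-shift : ∀ {a b} → a + b ≈ 0# → ∀ i → shift b (shift a i) ≡ i
    shift-shift {a} {b} a+b≈0 i = enum-injective _ _ (begin
      enum (shift b (shift a i))  ≈⟨ enum-index _ ⟩
      enum (shift a i) + b        ≈⟨ +-congʳ (enum-index _) ⟩
      enum i + a + b              ≈⟨ +-assoc (enum i) a b ⟩
      enum i + (a + b)            ≈⟨ +-congˡ a+b≈0 ⟩
      enum i + 0#                 ≈⟨ +-identityʳ (enum i) ⟩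
      enum i                      ∎)

    translation : Carrier → Permutation Q Q
    translation a = permutation (shift a) (shift (- a))
      (shift-shift (-‿inverseˡ a)) (shift-shift (-‿inverseʳ a))

  -- Translation by a permutes the elements, so Σ x = Σ (x + a) = Σ x + Q·a.
  card×≈0 : ∀ a → Q × a ≈ 0#
  card×≈0 a = +-cancelˡ (sum enum) (Q × a) 0# (begin
    sum enum + Q × a                    ≈⟨ +-congˡ (sum-replicate Q) ⟨
    sum enum + sum {Q} (λ _ → a)        ≈⟨ ∑-distrib-+ enum (λ _ → a) ⟨
    sum (λ i → enum i + a)              ≈⟨ sum-cong-≋ (λ i → enum-index (enum i + a)) ⟨
    sum (λ i → enum (shift a i))        ≈⟨ sum-permute enum (translation a) ⟨
    sum enum                            ≈⟨ +-identityʳ (sum enum) ⟨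
    sum enum + 0#                       ∎)

  card≡^⇒×1≈0 : ∀ {p} m → Q ≡ p ℕ.^ m → p × 1# ≈ 0#
  card≡^⇒×1≈0 {p} m Q≡pᵐ = ^≈0⇒≈0 _≟_ m (begin
    (p × 1#) ^ m      ≈⟨ ×1-homo-^ p m ⟨
    (p ℕ.^ m) × 1#    ≡⟨ ≡.cong (_× 1#) Q≡pᵐ ⟨
    Q × 1#            ≈⟨ card×≈0 1# ⟩
    0#                ∎)

module Polynomials {c r : Level} (F : Field c r) where
  open Field F hiding (zero)
  open FieldOps F
  open RingProperties ring using (-1*x≈-x)
  open FieldProperties F using (⁻¹-unique; ⁻¹-cong)
  open IntegerCoefficientSolver commutativeRing
  open import Data.Product using (_×_)
  open import Algebra.Properties.CommutativeSemigroup +-commutativeSemigroup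
    using () renaming (interchange to +-interchange)
  open import Algebra.Properties.CommutativeSemigroup *-commutativeSemigroup
    using (x∙yz≈y∙xz)
  open SetoidReasoning setoid

  -- A record around _≈ₚ_, whose unfolding to a Π-type would hide both polynomials from
  -- unification.
  infix 4 _≋_
  record _≋_ (p q : Poly) : Set r where
    constructor mk≋
    field coeff≈ : p ≈ₚ q
  open _≋_ public

  ≋-refl : ∀ {p} → p ≋ p
  ≋-refl = mk≋ λ _ → refl

  ≋-sym : ∀ {p q} → p ≋ q → q ≋ p
  ≋-sym (mk≋ p≈q) = mk≋ λ i → sym (p≈q i)

  ≋-trans : ∀ {p q s} → p ≋ q → q ≋ s → p ≋ s
  ≋-trans (mk≋ p≈q) (mk≋ q≈s) = mk≋ λ i → trans (p≈q i) (q≈s i)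

  ≋-setoid : Setoid c r
  ≋-setoid = record
    { Carrier = Poly
    ; _≈_ = _≋_
    ; isEquivalence = record { refl = ≋-refl ; sym = ≋-sym ; trans = ≋-trans }
    }

  module ≋ = SetoidReasoning ≋-setoid

  ∷-cong : ∀ {a b p q} → a ≈ b → p ≋ q → (a ∷ p) ≋ (b ∷ q)
  ∷-cong a≈b (mk≋ p≈q) = mk≋ λ { zero → a≈b ; (suc i) → p≈q i }

  ∷-injective : ∀ {a b p q} → (a ∷ p) ≋ (b ∷ q) → a ≈ b × p ≋ q
  ∷-injective (mk≋ eq) = eq zero , mk≋ (eq ∘ suc)

  ∷-≋[]⁺ : ∀ {a p} → a ≈ 0# → p ≋ [] → (a ∷ p) ≋ []
  ∷-≋[]⁺ a≈0 (mk≋ p≈0) = mk≋ λ { zero → a≈0 ; (suc i) → p≈0 i }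

  ∷-≋[]⁻ : ∀ {a p} → (a ∷ p) ≋ [] → a ≈ 0# × p ≋ []
  ∷-≋[]⁻ (mk≋ eq) = eq zero , mk≋ (eq ∘ suc)

  coeff-+ : ∀ p q i → coeff (p +ₚ q) i ≈ coeff p i + coeff q i
  coeff-+ []      q       i       = sym (+-identityˡ _)
  coeff-+ (a ∷ p) []      i       = sym (+-identityʳ _)
  coeff-+ (a ∷ p) (b ∷ q) zero    = refl
  coeff-+ (a ∷ p) (b ∷ q) (suc i) = coeff-+ p q i

  coeff-· : ∀ a p i → coeff (a ·ₚ p) i ≈ a * coeff p i
  coeff-· a []      i       = sym (zeroʳ a)
  coeff-· a (b ∷ p) zero    = refl
  coeff-· a (b ∷ p) (suc i) = coeff-· a p i

  +ₚ-cong : ∀ {p p′ q q′} → p ≋ p′ → q ≋ q′ → (p +ₚ q) ≋ (p′ +ₚ q′)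
  +ₚ-cong {p} {p′} {q} {q′} (mk≋ p≈p′) (mk≋ q≈q′) = mk≋ λ i → begin
    coeff (p +ₚ q) i          ≈⟨ coeff-+ p q i ⟩
    coeff p i + coeff q i     ≈⟨ +-cong (p≈p′ i) (q≈q′ i) ⟩
    coeff p′ i + coeff q′ i   ≈⟨ coeff-+ p′ q′ i ⟨
    coeff (p′ +ₚ q′) i        ∎

  +ₚ-congˡ : ∀ p {q q′} → q ≋ q′ → (p +ₚ q) ≋ (p +ₚ q′)
  +ₚ-congˡ p = +ₚ-cong (≋-refl {p})

  +ₚ-congʳ : ∀ {p p′} q → p ≋ p′ → (p +ₚ q) ≋ (p′ +ₚ q)
  +ₚ-congʳ q p≋p′ = +ₚ-cong p≋p′ (≋-refl {q})

  ·ₚ-cong : ∀ {a b p q} → a ≈ b → p ≋ q → (a ·ₚ p) ≋ (b ·ₚ q)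
  ·ₚ-cong {a} {b} {p} {q} a≈b (mk≋ p≈q) = mk≋ λ i → begin
    coeff (a ·ₚ p) i   ≈⟨ coeff-· a p i ⟩
    a * coeff p i      ≈⟨ *-cong a≈b (p≈q i) ⟩
    b * coeff q i      ≈⟨ coeff-· b q i ⟨
    coeff (b ·ₚ q) i   ∎

  -ₚ-cong : ∀ {p q} → p ≋ q → (-ₚ p) ≋ (-ₚ q)
  -ₚ-cong = ·ₚ-cong refl

  +ₚ-assoc : ∀ p q s → ((p +ₚ q) +ₚ s) ≋ (p +ₚ (q +ₚ s))
  +ₚ-assoc p q s = mk≋ λ i → begin
    coeff ((p +ₚ q) +ₚ s) i                ≈⟨ coeff-+ (p +ₚ q) s i ⟩
    coeff (p +ₚ q) i + coeff s i           ≈⟨ +-congʳ (coeff-+ p q i) ⟩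
    coeff p i + coeff q i + coeff s i      ≈⟨ +-assoc _ _ _ ⟩
    coeff p i + (coeff q i + coeff s i)    ≈⟨ +-congˡ (coeff-+ q s i) ⟨
    coeff p i + coeff (q +ₚ s) i           ≈⟨ coeff-+ p (q +ₚ s) i ⟨
    coeff (p +ₚ (q +ₚ s)) i                ∎

  +ₚ-comm : ∀ p q → (p +ₚ q) ≋ (q +ₚ p)
  +ₚ-comm p q = mk≋ λ i → trans (coeff-+ p q i) (trans (+-comm _ _) (sym (coeff-+ q p i)))

  +ₚ-identityʳ : ∀ p → (p +ₚ []) ≋ p
  +ₚ-identityʳ p = +ₚ-comm p []

  -ₚ-inverseʳ : ∀ p → (p +ₚ (-ₚ p)) ≋ []
  -ₚ-inverseʳ p = mk≋ λ i → begin
    coeff (p +ₚ (-ₚ p)) i              ≈⟨ coeff-+ p (-ₚ p) i ⟩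
    coeff p i + coeff (-ₚ p) i         ≈⟨ +-congˡ (coeff-· (- 1#) p i) ⟩
    coeff p i + - 1# * coeff p i       ≈⟨ +-congˡ (-1*x≈-x _) ⟩
    coeff p i - coeff p i              ≈⟨ -‿inverseʳ _ ⟩
    0#                                 ∎

  ·ₚ-distribˡ : ∀ a p q → (a ·ₚ (p +ₚ q)) ≋ ((a ·ₚ p) +ₚ (a ·ₚ q))
  ·ₚ-distribˡ a p q = mk≋ λ i → begin
    coeff (a ·ₚ (p +ₚ q)) i                 ≈⟨ coeff-· a (p +ₚ q) i ⟩
    a * coeff (p +ₚ q) i                    ≈⟨ *-congˡ (coeff-+ p q i) ⟩
    a * (coeff p i + coeff q i)             ≈⟨ distribˡ _ _ _ ⟩
    a * coeff p i + a * coeff q i           ≈⟨ +-cong (coeff-· a p i) (coeff-· a q i) ⟨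
    coeff (a ·ₚ p) i + coeff (a ·ₚ q) i     ≈⟨ coeff-+ (a ·ₚ p) (a ·ₚ q) i ⟨
    coeff ((a ·ₚ p) +ₚ (a ·ₚ q)) i          ∎

  ·ₚ-distribʳ : ∀ a b p → ((a + b) ·ₚ p) ≋ ((a ·ₚ p) +ₚ (b ·ₚ p))
  ·ₚ-distribʳ a b p = mk≋ λ i → begin
    coeff ((a + b) ·ₚ p) i                  ≈⟨ coeff-· (a + b) p i ⟩
    (a + b) * coeff p i                     ≈⟨ distribʳ _ _ _ ⟩
    a * coeff p i + b * coeff p i           ≈⟨ +-cong (coeff-· a p i) (coeff-· b p i) ⟨
    coeff (a ·ₚ p) i + coeff (b ·ₚ p) i     ≈⟨ coeff-+ (a ·ₚ p) (b ·ₚ p) i ⟨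
    coeff ((a ·ₚ p) +ₚ (b ·ₚ p)) i          ∎

  ·ₚ-assoc : ∀ a b p → (a ·ₚ (b ·ₚ p)) ≋ ((a * b) ·ₚ p)
  ·ₚ-assoc a b p = mk≋ λ i → begin
    coeff (a ·ₚ (b ·ₚ p)) i   ≈⟨ coeff-· a (b ·ₚ p) i ⟩
    a * coeff (b ·ₚ p) i      ≈⟨ *-congˡ (coeff-· b p i) ⟩
    a * (b * coeff p i)       ≈⟨ *-assoc _ _ _ ⟨
    a * b * coeff p i         ≈⟨ coeff-· (a * b) p i ⟨
    coeff ((a * b) ·ₚ p) i    ∎

  ·ₚ-identityˡ : ∀ p → (1# ·ₚ p) ≋ p
  ·ₚ-identityˡ p = mk≋ λ i → trans (coeff-· 1# p i) (*-identityˡ _)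

  ·ₚ-zeroˡ : ∀ p → (0# ·ₚ p) ≋ []
  ·ₚ-zeroˡ p = mk≋ λ i → trans (coeff-· 0# p i) (zeroˡ _)

  ·ₚ-zeroʳ : ∀ a {p} → p ≋ [] → (a ·ₚ p) ≋ []
  ·ₚ-zeroʳ a {p} (mk≋ p≈0) = mk≋ λ i → trans (coeff-· a p i) (trans (*-congˡ (p≈0 i)) (zeroʳ a))

  0∷-+ₚ : ∀ p q → (0# ∷ (p +ₚ q)) ≋ ((0# ∷ p) +ₚ (0# ∷ q))
  0∷-+ₚ p q = ∷-cong (sym (+-identityʳ 0#)) ≋-refl

  +ₚ-interchange : ∀ p q s t → ((p +ₚ q) +ₚ (s +ₚ t)) ≋ ((p +ₚ s) +ₚ (q +ₚ t))
  +ₚ-interchange p q s t = mk≋ λ i → begin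
    coeff ((p +ₚ q) +ₚ (s +ₚ t)) i                      ≈⟨ coeff-+-+ p q s t i ⟩
    (coeff p i + coeff q i) + (coeff s i + coeff t i)   ≈⟨ +-interchange _ _ _ _ ⟩
    (coeff p i + coeff s i) + (coeff q i + coeff t i)   ≈⟨ coeff-+-+ p s q t i ⟨
    coeff ((p +ₚ s) +ₚ (q +ₚ t)) i                      ∎
    where
    coeff-+-+ : ∀ p q s t i →
      coeff ((p +ₚ q) +ₚ (s +ₚ t)) i ≈ (coeff p i + coeff q i) + (coeff s i + coeff t i)
    coeff-+-+ p q s t i = trans (coeff-+ (p +ₚ q) (s +ₚ t) i) (+-cong (coeff-+ p q i) (coeff-+ s t i))

  *ₚ-zeroˡ : ∀ {p} q → p ≋ [] → (p *ₚ q) ≋ []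
  *ₚ-zeroˡ {[]}    q _    = ≋-refl
  *ₚ-zeroˡ {a ∷ p} q a∷p≋[] with ∷-≋[]⁻ a∷p≋[]
  ... | a≈0 , p≋[] = +ₚ-cong (≋-trans (·ₚ-cong a≈0 ≋-refl) (·ₚ-zeroˡ q)) (∷-≋[]⁺ refl (*ₚ-zeroˡ q p≋[]))

  *ₚ-zeroʳ : ∀ p {q} → q ≋ [] → (p *ₚ q) ≋ []
  *ₚ-zeroʳ []      _    = ≋-refl
  *ₚ-zeroʳ (a ∷ p) q≋[] = +ₚ-cong (·ₚ-zeroʳ a q≋[]) (∷-≋[]⁺ refl (*ₚ-zeroʳ p q≋[]))

  *ₚ-congˡ : ∀ {p p′} q → p ≋ p′ → (p *ₚ q) ≋ (p′ *ₚ q)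
  *ₚ-congˡ {[]}    {p′}     q p≋p′ = ≋-sym (*ₚ-zeroˡ q (≋-sym p≋p′))
  *ₚ-congˡ {a ∷ p} {[]}     q p≋p′ = *ₚ-zeroˡ q p≋p′
  *ₚ-congˡ {a ∷ p} {b ∷ p′} q p≋p′ with ∷-injective p≋p′
  ... | a≈b , p≋p′ = +ₚ-cong (·ₚ-cong a≈b ≋-refl) (∷-cong refl (*ₚ-congˡ q p≋p′))

  *ₚ-congʳ : ∀ p {q q′} → q ≋ q′ → (p *ₚ q) ≋ (p *ₚ q′)
  *ₚ-congʳ []      q≋q′ = ≋-refl
  *ₚ-congʳ (a ∷ p) q≋q′ = +ₚ-cong (·ₚ-cong refl q≋q′) (∷-cong refl (*ₚ-congʳ p q≋q′))

  *ₚ-cong : ∀ {p p′ q q′} → p ≋ p′ → q ≋ q′ → (p *ₚ q) ≋ (p′ *ₚ q′)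
  *ₚ-cong {p′ = p′} {q} p≋p′ q≋q′ = ≋-trans (*ₚ-congˡ q p≋p′) (*ₚ-congʳ p′ q≋q′)

  0∷-*ₚ : ∀ p q → ((0# ∷ p) *ₚ q) ≋ (0# ∷ (p *ₚ q))
  0∷-*ₚ p q = +ₚ-congʳ (0# ∷ (p *ₚ q)) (·ₚ-zeroˡ q)

  *ₚ-distribʳ : ∀ p q s → ((p +ₚ q) *ₚ s) ≋ ((p *ₚ s) +ₚ (q *ₚ s))
  *ₚ-distribʳ []      q       s = ≋-refl
  *ₚ-distribʳ (a ∷ p) []      s = ≋-sym (+ₚ-identityʳ ((a ∷ p) *ₚ s))
  *ₚ-distribʳ (a ∷ p) (b ∷ q) s = ≋-trans
    (+ₚ-cong (·ₚ-distribʳ a b s) (≋-trans (∷-cong refl (*ₚ-distribʳ p q s)) (0∷-+ₚ (p *ₚ s) (q *ₚ s))))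
    (+ₚ-interchange (a ·ₚ s) (b ·ₚ s) (0# ∷ (p *ₚ s)) (0# ∷ (q *ₚ s)))

  ·ₚ-*ₚ : ∀ a p q → ((a ·ₚ p) *ₚ q) ≋ (a ·ₚ (p *ₚ q))
  ·ₚ-*ₚ a []      q = ≋-refl
  ·ₚ-*ₚ a (b ∷ p) q = ≋-trans
    (+ₚ-cong (≋-sym (·ₚ-assoc a b q)) (∷-cong (sym (zeroʳ a)) (·ₚ-*ₚ a p q)))
    (≋-sym (·ₚ-distribˡ a (b ·ₚ q) (0# ∷ (p *ₚ q))))

  *ₚ-assoc : ∀ p q s → ((p *ₚ q) *ₚ s) ≋ (p *ₚ (q *ₚ s))
  *ₚ-assoc []      q s = ≋-refl
  *ₚ-assoc (a ∷ p) q s = ≋-trans (*ₚ-distribʳ (a ·ₚ q) (0# ∷ (p *ₚ q)) s)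
    (+ₚ-cong (·ₚ-*ₚ a q s) (≋-trans (0∷-*ₚ (p *ₚ q) s) (∷-cong refl (*ₚ-assoc p q s))))

  *ₚ-∷ʳ : ∀ p b q → (p *ₚ (b ∷ q)) ≋ ((b ·ₚ p) +ₚ (0# ∷ (p *ₚ q)))
  *ₚ-∷ʳ []      b q = ≋-sym (∷-≋[]⁺ refl ≋-refl)
  *ₚ-∷ʳ (a ∷ p) b q = ∷-cong (+-congʳ (*-comm a b)) (≋.begin
    (a ·ₚ q) +ₚ (p *ₚ (b ∷ q))                  ≋.≈⟨ +ₚ-congˡ (a ·ₚ q) (*ₚ-∷ʳ p b q) ⟩
    (a ·ₚ q) +ₚ ((b ·ₚ p) +ₚ (0# ∷ (p *ₚ q)))     ≋.≈⟨ +ₚ-assoc (a ·ₚ q) (b ·ₚ p) _ ⟨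
    ((a ·ₚ q) +ₚ (b ·ₚ p)) +ₚ (0# ∷ (p *ₚ q))     ≋.≈⟨ +ₚ-congʳ (0# ∷ (p *ₚ q)) (+ₚ-comm (a ·ₚ q) (b ·ₚ p)) ⟩
    ((b ·ₚ p) +ₚ (a ·ₚ q)) +ₚ (0# ∷ (p *ₚ q))     ≋.≈⟨ +ₚ-assoc (b ·ₚ p) (a ·ₚ q) _ ⟩
    (b ·ₚ p) +ₚ ((a ·ₚ q) +ₚ (0# ∷ (p *ₚ q)))     ≋.∎)

  *ₚ-comm : ∀ p q → (p *ₚ q) ≋ (q *ₚ p)
  *ₚ-comm []      q = ≋-sym (*ₚ-zeroʳ q ≋-refl)
  *ₚ-comm (a ∷ p) q = ≋-trans (+ₚ-congˡ (a ·ₚ q) (∷-cong refl (*ₚ-comm p q))) (≋-sym (*ₚ-∷ʳ q a p))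

  *ₚ-·ₚ : ∀ p b q → (p *ₚ (b ·ₚ q)) ≋ (b ·ₚ (p *ₚ q))
  *ₚ-·ₚ p b q = ≋-trans (*ₚ-comm p (b ·ₚ q)) (≋-trans (·ₚ-*ₚ b q p) (·ₚ-cong refl (*ₚ-comm q p)))

  constant-*ₚ : ∀ a p → ((a ∷ []) *ₚ p) ≋ (a ·ₚ p)
  constant-*ₚ a p = ≋-trans (+ₚ-congˡ (a ·ₚ p) (∷-≋[]⁺ refl ≋-refl)) (+ₚ-identityʳ (a ·ₚ p))

  *ₚ-identityˡ : ∀ p → ((1# ∷ []) *ₚ p) ≋ p
  *ₚ-identityˡ p = ≋-trans (constant-*ₚ 1# p) (·ₚ-identityˡ p)

  polynomialRing : CommutativeRing c r
  polynomialRing = record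
    { Carrier = Poly
    ; _≈_ = _≋_
    ; _+_ = _+ₚ_
    ; _*_ = _*ₚ_
    ; -_ = -ₚ_
    ; 0# = []
    ; 1# = 1# ∷ []
    ; isCommutativeRing = record
      { isRing = record
        { +-isAbelianGroup = record
          { isGroup = record
            { isMonoid = record
              { isSemigroup = record
                { isMagma = record
                  { isEquivalence = Setoid.isEquivalence ≋-setoid
                  ; ∙-cong = +ₚ-cong
                  }
                ; assoc = +ₚ-assoc
                }
              ; identity = (λ _ → ≋-refl) , +ₚ-identityʳ
              }
            ; inverse = (λ p → ≋-trans (+ₚ-comm (-ₚ p) p) (-ₚ-inverseʳ p)) , -ₚ-inverseʳ
            ; ⁻¹-cong = -ₚ-cong
            }
          ; comm = +ₚ-comm
          }
        ; *-cong = *ₚ-cong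
        ; *-assoc = *ₚ-assoc
        ; *-identity = *ₚ-identityˡ , (λ p → ≋-trans (*ₚ-comm p (1# ∷ [])) (*ₚ-identityˡ p))
        ; distrib = (λ p q s → ≋-trans (*ₚ-comm p (q +ₚ s))
                      (≋-trans (*ₚ-distribʳ q s p) (+ₚ-cong (*ₚ-comm q p) (*ₚ-comm s p))))
                  , (λ s p q → *ₚ-distribʳ p q s)
        }
      ; *-comm = *ₚ-comm
      }
    }

  coeff-derivFrom : ∀ k p i → coeff (derivFrom k p) i ≈ nat (k ℕ.+ i) * coeff p i
  coeff-derivFrom k []      i       = sym (zeroʳ _)
  coeff-derivFrom k (a ∷ p) zero    = *-congʳ (reflexive (≡.cong nat (≡.sym (ℕ.+-identityʳ k))))
  coeff-derivFrom k (a ∷ p) (suc i) =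
    trans (coeff-derivFrom (suc k) p i) (*-congʳ (reflexive (≡.cong nat (≡.sym (ℕ.+-suc k i)))))

  coeff-deriv : ∀ p i → coeff (deriv p) i ≈ nat (suc i) * coeff p (suc i)
  coeff-deriv []      i = sym (zeroʳ _)
  coeff-deriv (a ∷ p) i = coeff-derivFrom 1 p i

  deriv-cong : ∀ {p q} → p ≋ q → deriv p ≋ deriv q
  deriv-cong {p} {q} (mk≋ p≈q) = mk≋ λ i → begin
    coeff (deriv p) i                ≈⟨ coeff-deriv p i ⟩
    nat (suc i) * coeff p (suc i)    ≈⟨ *-congˡ (p≈q (suc i)) ⟩
    nat (suc i) * coeff q (suc i)    ≈⟨ coeff-deriv q i ⟨
    coeff (deriv q) i                ∎

  deriv-+ₚ : ∀ p q → deriv (p +ₚ q) ≋ (deriv p +ₚ deriv q)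
  deriv-+ₚ p q = mk≋ λ i → begin
    coeff (deriv (p +ₚ q)) i                                       ≈⟨ coeff-deriv (p +ₚ q) i ⟩
    nat (suc i) * coeff (p +ₚ q) (suc i)                           ≈⟨ *-congˡ (coeff-+ p q (suc i)) ⟩
    nat (suc i) * (coeff p (suc i) + coeff q (suc i))              ≈⟨ distribˡ _ _ _ ⟩
    nat (suc i) * coeff p (suc i) + nat (suc i) * coeff q (suc i)  ≈⟨ +-cong (coeff-deriv p i) (coeff-deriv q i) ⟨
    coeff (deriv p) i + coeff (deriv q) i                          ≈⟨ coeff-+ (deriv p) (deriv q) i ⟨
    coeff (deriv p +ₚ deriv q) i                                   ∎

  deriv-·ₚ : ∀ a p → deriv (a ·ₚ p) ≋ (a ·ₚ deriv p)
  deriv-·ₚ a p = mk≋ λ i → begin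
    coeff (deriv (a ·ₚ p)) i                ≈⟨ coeff-deriv (a ·ₚ p) i ⟩
    nat (suc i) * coeff (a ·ₚ p) (suc i)    ≈⟨ *-congˡ (coeff-· a p (suc i)) ⟩
    nat (suc i) * (a * coeff p (suc i))     ≈⟨ x∙yz≈y∙xz _ _ _ ⟩
    a * (nat (suc i) * coeff p (suc i))     ≈⟨ *-congˡ (coeff-deriv p i) ⟨
    a * coeff (deriv p) i                   ≈⟨ coeff-· a (deriv p) i ⟨
    coeff (a ·ₚ deriv p) i                  ∎

  deriv-0∷ : ∀ p → deriv (0# ∷ p) ≋ (p +ₚ (0# ∷ deriv p))
  deriv-0∷ p = mk≋ λ
    { zero → begin
        coeff (deriv (0# ∷ p)) zero          ≈⟨ coeff-deriv (0# ∷ p) zero ⟩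
        (1# + 0#) * coeff p zero             ≈⟨ *-congʳ (+-identityʳ 1#) ⟩
        1# * coeff p zero                    ≈⟨ *-identityˡ _ ⟩
        coeff p zero                         ≈⟨ +-identityʳ _ ⟨
        coeff p zero + 0#                    ≈⟨ coeff-+ p (0# ∷ deriv p) zero ⟨
        coeff (p +ₚ (0# ∷ deriv p)) zero     ∎
    ; (suc i) → begin
        coeff (deriv (0# ∷ p)) (suc i)                         ≈⟨ coeff-deriv (0# ∷ p) (suc i) ⟩
        (1# + nat (suc i)) * coeff p (suc i)                   ≈⟨ distribʳ _ _ _ ⟩
        1# * coeff p (suc i) + nat (suc i) * coeff p (suc i)   ≈⟨ +-cong (*-identityˡ _) (sym (coeff-deriv p i)) ⟩
        coeff p (suc i) + coeff (deriv p) i                    ≈⟨ coeff-+ p (0# ∷ deriv p) (suc i) ⟨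
        coeff (p +ₚ (0# ∷ deriv p)) (suc i)                    ∎
    }

  powerDiff : Carrier → Carrier → ℕ → Poly
  powerDiff a b m = ((b - a) ⁻¹) ·ₚ (((X- a) ^ₚ m) +ₚ (-ₚ ((X- b) ^ₚ m)))

  coeff-powerDiff : ∀ a b m i →
    coeff (powerDiff a b m) i ≈ (b - a) ⁻¹ * (coeff ((X- a) ^ₚ m) i - coeff ((X- b) ^ₚ m) i)
  coeff-powerDiff a b m i = begin
    coeff (powerDiff a b m) i                                  ≈⟨ coeff-· _ (Aᵐ +ₚ (-ₚ Bᵐ)) i ⟩
    (b - a) ⁻¹ * coeff (Aᵐ +ₚ (-ₚ Bᵐ)) i                      ≈⟨ *-congˡ (coeff-+ Aᵐ (-ₚ Bᵐ) i) ⟩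
    (b - a) ⁻¹ * (coeff Aᵐ i + coeff (-ₚ Bᵐ) i)               ≈⟨ *-congˡ (+-congˡ (coeff-· (- 1#) Bᵐ i)) ⟩
    (b - a) ⁻¹ * (coeff Aᵐ i + - 1# * coeff Bᵐ i)             ≈⟨ *-congˡ (+-congˡ (-1*x≈-x _)) ⟩
    (b - a) ⁻¹ * (coeff Aᵐ i - coeff Bᵐ i)                    ∎
    where
    Aᵐ = (X- a) ^ₚ m
    Bᵐ = (X- b) ^ₚ m

  powerDiff-swap : ∀ {a b} → ¬ b - a ≈ 0# → ∀ m → powerDiff a b m ≋ powerDiff b a m
  powerDiff-swap {a} {b} b-a≉0 m = mk≋ λ i → begin
    coeff (powerDiff a b m) i                   ≈⟨ coeff-powerDiff a b m i ⟩
    (b - a) ⁻¹ * (coeff Aᵐ i - coeff Bᵐ i)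
      ≈⟨ solve 3 (λ k x y → k :* (x :- y) := :- k :* (y :- x)) refl _ _ _ ⟩
    - (b - a) ⁻¹ * (coeff Bᵐ i - coeff Aᵐ i)    ≈⟨ *-congʳ [a-b]⁻¹≈-[b-a]⁻¹ ⟨
    (a - b) ⁻¹ * (coeff Bᵐ i - coeff Aᵐ i)      ≈⟨ coeff-powerDiff b a m i ⟨
    coeff (powerDiff b a m) i                   ∎
    where
    Aᵐ = (X- a) ^ₚ m
    Bᵐ = (X- b) ^ₚ m
    [a-b]⁻¹≈-[b-a]⁻¹ : (a - b) ⁻¹ ≈ - (b - a) ⁻¹
    [a-b]⁻¹≈-[b-a]⁻¹ = sym (⁻¹-unique (begin
      (a - b) * - (b - a) ⁻¹   ≈⟨ solve 3 (λ a b k → (a :- b) :* :- k := (b :- a) :* k) refl a b _ ⟩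
      (b - a) * (b - a) ⁻¹     ≈⟨ ⁻¹-inverse (b - a) b-a≉0 ⟩
      1#                       ∎))

  X-cong : ∀ {a b} → a ≈ b → (X- a) ≋ (X- b)
  X-cong a≈b = ∷-cong (-‿cong a≈b) ≋-refl

  ^ₚ-cong : ∀ {p q} n → p ≋ q → (p ^ₚ n) ≋ (q ^ₚ n)
  ^ₚ-cong zero    p≋q = ≋-refl
  ^ₚ-cong (suc n) p≋q = *ₚ-cong p≋q (^ₚ-cong n p≋q)

  powerDiff-cong : ∀ {a a′ b b′} → ¬ b - a ≈ 0# → a ≈ a′ → b ≈ b′ → ∀ m →
    powerDiff a b m ≋ powerDiff a′ b′ m
  powerDiff-cong b-a≉0 a≈a′ b≈b′ m =
    ·ₚ-cong (⁻¹-cong b-a≉0 (+-cong b≈b′ (-‿cong a≈a′)))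
            (+ₚ-cong (^ₚ-cong m (X-cong a≈a′)) (-ₚ-cong (^ₚ-cong m (X-cong b≈b′))))

module PolynomialMap {c r : Level} (F : Field c r) {φ : Field.Carrier F → Field.Carrier F}
  (φ-isRingHomomorphism : IsRingHomomorphism (Field.rawRing F) (Field.rawRing F) φ) where
  open Field F hiding (zero)
  open FieldOps F
  open Polynomials F
  open IsRingHomomorphism φ-isRingHomomorphism
  open FieldProperties F using (⁻¹-cong)
  open FieldHomomorphism F φ-isRingHomomorphism using (-homo; ⁻¹-homo; φ≉0)

  mapₚ : Poly → Poly
  mapₚ = List.map φ

  mapₚ-+ₚ : ∀ p q → mapₚ (p +ₚ q) ≋ (mapₚ p +ₚ mapₚ q)
  mapₚ-+ₚ []      q       = ≋-refl
  mapₚ-+ₚ (a ∷ p) []      = ≋-refl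
  mapₚ-+ₚ (a ∷ p) (b ∷ q) = ∷-cong (+-homo a b) (mapₚ-+ₚ p q)

  mapₚ-·ₚ : ∀ a p → mapₚ (a ·ₚ p) ≋ (φ a ·ₚ mapₚ p)
  mapₚ-·ₚ a []      = ≋-refl
  mapₚ-·ₚ a (b ∷ p) = ∷-cong (*-homo a b) (mapₚ-·ₚ a p)

  mapₚ--ₚ : ∀ p → mapₚ (-ₚ p) ≋ (-ₚ mapₚ p)
  mapₚ--ₚ p = ≋-trans (mapₚ-·ₚ (- 1#) p) (·ₚ-cong (trans (-‿homo 1#) (-‿cong 1#-homo)) ≋-refl)

  mapₚ-*ₚ : ∀ p q → mapₚ (p *ₚ q) ≋ (mapₚ p *ₚ mapₚ q)
  mapₚ-*ₚ []      q = ≋-refl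
  mapₚ-*ₚ (a ∷ p) q = ≋-trans (mapₚ-+ₚ (a ·ₚ q) (0# ∷ (p *ₚ q)))
    (+ₚ-cong (mapₚ-·ₚ a q) (∷-cong 0#-homo (mapₚ-*ₚ p q)))

  mapₚ-^ₚ : ∀ p n → mapₚ (p ^ₚ n) ≋ (mapₚ p ^ₚ n)
  mapₚ-^ₚ p zero    = ∷-cong 1#-homo ≋-refl
  mapₚ-^ₚ p (suc n) = ≋-trans (mapₚ-*ₚ p (p ^ₚ n)) (*ₚ-congʳ (mapₚ p) (mapₚ-^ₚ p n))

  mapₚ-X- : ∀ a → mapₚ (X- a) ≋ (X- φ a)
  mapₚ-X- a = ∷-cong (-‿homo a) (∷-cong 1#-homo ≋-refl)

  mapₚ-powerDiff : ∀ {a b} → ¬ b - a ≈ 0# → ∀ m → mapₚ (powerDiff a b m) ≋ powerDiff (φ a) (φ b) m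
  mapₚ-powerDiff {a} {b} b-a≉0 m = ≋-trans (mapₚ-·ₚ ((b - a) ⁻¹) _)
    (·ₚ-cong φ[[b-a]⁻¹]≈[φb-φa]⁻¹
      (≋-trans (mapₚ-+ₚ ((X- a) ^ₚ m) _)
        (+ₚ-cong (mapX-^ a) (≋-trans (mapₚ--ₚ ((X- b) ^ₚ m)) (-ₚ-cong (mapX-^ b))))))
    where
    mapX-^ : ∀ x → mapₚ ((X- x) ^ₚ m) ≋ ((X- φ x) ^ₚ m)
    mapX-^ x = ≋-trans (mapₚ-^ₚ (X- x) m) (^ₚ-cong m (mapₚ-X- x))
    φ[[b-a]⁻¹]≈[φb-φa]⁻¹ : φ ((b - a) ⁻¹) ≈ (φ b - φ a) ⁻¹
    φ[[b-a]⁻¹]≈[φb-φa]⁻¹ = trans (⁻¹-homo b-a≉0)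
      (⁻¹-cong (φ≉0 b-a≉0) (-homo b a))

  powerDiff-fixed : ∀ {a b} → ¬ b - a ≈ 0# → φ a ≈ b → φ b ≈ a → ∀ m →
    mapₚ (powerDiff a b m) ≋ powerDiff a b m
  powerDiff-fixed {a} {b} b-a≉0 φa≈b φb≈a m = ≋-trans (mapₚ-powerDiff b-a≉0 m)
    (≋-trans (powerDiff-cong φb-φa≉0 φa≈b φb≈a m) (≋-sym (powerDiff-swap b-a≉0 m)))
    where
    φb-φa≉0 : ¬ φ b - φ a ≈ 0#
    φb-φa≉0 φb-φa≈0 = φ≉0 b-a≉0 (trans (-homo b a) φb-φa≈0)

  mapₚ≋⇒All : ∀ {p} → mapₚ p ≋ p → All (λ x → φ x ≈ x) p
  mapₚ≋⇒All {[]}    _   = []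
  mapₚ≋⇒All {x ∷ p} eq  = proj₁ (∷-injective eq) ∷ mapₚ≋⇒All (proj₂ (∷-injective eq))

module Separability {c r : Level} (F : Field c r) where
  open Field F hiding (zero)
  open FieldOps F
  open Polynomials F
  open RingProperties ring using (-1*x≈-x; -‿involutive)
  private module P = CommutativeRing polynomialRing
  open RingProperties P.ring using () renaming (x[y-z]≈xy-xz to *ₚ-distribˡ--ₚ)
  open import Algebra.Properties.Semiring.Exp P.semiring using () renaming (_^_ to _^ᴾ_)
  open import Algebra.Properties.CommutativeSemigroup P.+-commutativeSemigroup
    using () renaming (x∙yz≈y∙xz to +ₚ-left-comm)
  open CoprimeElements polynomialRing using (Coprime; powerDifferences-coprime)
  open ≋

  ^ₚ≡^ᴾ : ∀ p n → p ^ₚ n ≡ p ^ᴾ n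
  ^ₚ≡^ᴾ p zero    = ≡.refl
  ^ₚ≡^ᴾ p (suc n) = ≡.cong (p *ₚ_) (^ₚ≡^ᴾ p n)

  deriv-X-*ₚ : ∀ a p → deriv ((X- a) *ₚ p) ≋ (p +ₚ ((X- a) *ₚ deriv p))
  deriv-X-*ₚ a p = begin
    deriv (((- a) ·ₚ p) +ₚ (0# ∷ (𝟙 *ₚ p)))         ≈⟨ deriv-+ₚ ((- a) ·ₚ p) (0# ∷ (𝟙 *ₚ p)) ⟩
    deriv ((- a) ·ₚ p) +ₚ deriv (0# ∷ (𝟙 *ₚ p))     ≈⟨ +ₚ-cong (deriv-·ₚ (- a) p) (deriv-0∷ (𝟙 *ₚ p)) ⟩
    -a·p′ +ₚ ((𝟙 *ₚ p) +ₚ (0# ∷ deriv (𝟙 *ₚ p)))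
      ≈⟨ +ₚ-congˡ -a·p′ (+ₚ-cong (*ₚ-identityˡ p) (∷-cong refl (deriv-cong (*ₚ-identityˡ p)))) ⟩
    -a·p′ +ₚ (p +ₚ (0# ∷ deriv p))                   ≈⟨ +ₚ-left-comm -a·p′ p _ ⟩
    p +ₚ (-a·p′ +ₚ (0# ∷ deriv p))
      ≈⟨ +ₚ-congˡ p (+ₚ-congˡ -a·p′ (∷-cong refl (≋-sym (*ₚ-identityˡ (deriv p))))) ⟩
    p +ₚ ((X- a) *ₚ deriv p)                        ∎
    where
    𝟙 = 1# ∷ []
    -a·p′ = (- a) ·ₚ deriv p

  deriv-^ₚ : ∀ a n → deriv ((X- a) ^ₚ suc n) ≋ (nat (suc n) ·ₚ ((X- a) ^ₚ n))
  deriv-^ₚ a zero = begin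
    deriv ((X- a) *ₚ (1# ∷ []))                      ≈⟨ deriv-X-*ₚ a (1# ∷ []) ⟩
    (1# ∷ []) +ₚ ((X- a) *ₚ [])                      ≈⟨ +ₚ-congˡ (1# ∷ []) (*ₚ-zeroʳ (X- a) ≋-refl) ⟩
    (1# ∷ []) +ₚ []                                  ≈⟨ +ₚ-identityʳ (1# ∷ []) ⟩
    1# ∷ []                                          ≈⟨ ∷-cong 1≈[1+0]*1 ≋-refl ⟩
    nat 1 ·ₚ (1# ∷ [])                               ∎
    where
    1≈[1+0]*1 : 1# ≈ (1# + 0#) * 1#
    1≈[1+0]*1 = sym (trans (*-identityʳ (1# + 0#)) (+-identityʳ 1#))
  deriv-^ₚ a (suc n) = begin
    deriv ((X- a) *ₚ Aⁿ⁺¹)                            ≈⟨ deriv-X-*ₚ a Aⁿ⁺¹ ⟩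
    Aⁿ⁺¹ +ₚ ((X- a) *ₚ deriv Aⁿ⁺¹)                    ≈⟨ +ₚ-congˡ Aⁿ⁺¹ (*ₚ-congʳ (X- a) (deriv-^ₚ a n)) ⟩
    Aⁿ⁺¹ +ₚ ((X- a) *ₚ (nat (suc n) ·ₚ Aⁿ))
      ≈⟨ +ₚ-cong (≋-sym (·ₚ-identityˡ Aⁿ⁺¹)) (*ₚ-·ₚ (X- a) (nat (suc n)) Aⁿ) ⟩
    (1# ·ₚ Aⁿ⁺¹) +ₚ (nat (suc n) ·ₚ Aⁿ⁺¹)             ≈⟨ ·ₚ-distribʳ 1# (nat (suc n)) Aⁿ⁺¹ ⟨
    nat (suc (suc n)) ·ₚ Aⁿ⁺¹                         ∎
    where
    Aⁿ = (X- a) ^ₚ n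
    Aⁿ⁺¹ = (X- a) ^ₚ suc n

  powerDiff-separable : ∀ {a b} m → ¬ b - a ≈ 0# → ¬ nat m ≈ 0# → IsSeparable (powerDiff a b m)
  powerDiff-separable zero    _      0≉0 = ⊥-elim (0≉0 refl)
  powerDiff-separable {a} {b} (suc n) b-a≉0 m≉0 =
    separable (powerDifferences-coprime {K} {A} {B} {L} {L⁻¹} n K[A-B]≋1 L⁻¹L≋1)
    where
    A = X- a
    B = X- b
    K = ((b - a) ⁻¹) ∷ []
    L = nat (suc n) ∷ []
    L⁻¹ = (nat (suc n) ⁻¹) ∷ []

    A-B≋b-a : (A +ₚ (-ₚ B)) ≋ ((b - a) ∷ [])
    A-B≋b-a = ∷-cong (trans (+-congˡ (trans (-1*x≈-x (- b)) (-‿involutive b))) (+-comm (- a) b))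
                     (∷-≋[]⁺ (trans (+-congˡ (-1*x≈-x 1#)) (-‿inverseʳ 1#)) ≋-refl)

    K[A-B]≋1 : (K *ₚ (A +ₚ (-ₚ B))) ≋ (1# ∷ [])
    K[A-B]≋1 = ≋-trans (*ₚ-congʳ K A-B≋b-a)
      (≋-trans (constant-*ₚ _ _) (∷-cong (trans (*-comm _ _) (⁻¹-inverse (b - a) b-a≉0)) ≋-refl))

    L⁻¹L≋1 : (L⁻¹ *ₚ L) ≋ (1# ∷ [])
    L⁻¹L≋1 = ≋-trans (constant-*ₚ _ _)
      (∷-cong (trans (*-comm _ _) (⁻¹-inverse (nat (suc n)) m≉0)) ≋-refl)

    powerDiff≋ : powerDiff a b (suc n) ≋ (K *ₚ ((A ^ᴾ suc n) +ₚ (-ₚ (B ^ᴾ suc n))))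
    powerDiff≋ rewrite ^ₚ≡^ᴾ A (suc n) | ^ₚ≡^ᴾ B (suc n) = ≋-sym (constant-*ₚ _ _)

    deriv-powerDiff≋ : deriv (powerDiff a b (suc n)) ≋ (K *ₚ (L *ₚ ((A ^ᴾ n) +ₚ (-ₚ (B ^ᴾ n)))))
    deriv-powerDiff≋ rewrite ≡.sym (^ₚ≡^ᴾ A n) | ≡.sym (^ₚ≡^ᴾ B n) = begin
      deriv (k ·ₚ (Aⁿ⁺¹ +ₚ (-ₚ Bⁿ⁺¹)))              ≈⟨ deriv-·ₚ _ (Aⁿ⁺¹ +ₚ (-ₚ Bⁿ⁺¹)) ⟩
      k ·ₚ deriv (Aⁿ⁺¹ +ₚ (-ₚ Bⁿ⁺¹))                ≈⟨ ·ₚ-cong refl (deriv-+ₚ Aⁿ⁺¹ (-ₚ Bⁿ⁺¹)) ⟩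
      k ·ₚ (deriv Aⁿ⁺¹ +ₚ deriv (-ₚ Bⁿ⁺¹))
        ≈⟨ ·ₚ-cong refl (+ₚ-cong (deriv-^ₚ a n) (deriv-·ₚ (- 1#) Bⁿ⁺¹)) ⟩
      k ·ₚ ((nat (suc n) ·ₚ Aⁿ) +ₚ (-ₚ deriv Bⁿ⁺¹))
        ≈⟨ ·ₚ-cong refl (+ₚ-congˡ _ (-ₚ-cong (deriv-^ₚ b n))) ⟩
      k ·ₚ ((nat (suc n) ·ₚ Aⁿ) +ₚ (-ₚ (nat (suc n) ·ₚ Bⁿ)))
        ≈⟨ ·ₚ-cong refl (+ₚ-cong (constant-*ₚ _ Aⁿ) (-ₚ-cong (constant-*ₚ _ Bⁿ))) ⟨
      k ·ₚ ((L *ₚ Aⁿ) +ₚ (-ₚ (L *ₚ Bⁿ)))              ≈⟨ constant-*ₚ k _ ⟨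
      K *ₚ ((L *ₚ Aⁿ) +ₚ (-ₚ (L *ₚ Bⁿ)))              ≈⟨ *ₚ-congʳ K (*ₚ-distribˡ--ₚ L Aⁿ Bⁿ) ⟨
      K *ₚ (L *ₚ (Aⁿ +ₚ (-ₚ Bⁿ)))                     ∎
      where
      k = (b - a) ⁻¹
      Aⁿ = A ^ₚ n
      Bⁿ = B ^ₚ n
      Aⁿ⁺¹ = A ^ₚ suc n
      Bⁿ⁺¹ = B ^ₚ suc n

    separable : Coprime (K *ₚ ((A ^ᴾ suc n) +ₚ (-ₚ (B ^ᴾ suc n))))
                        (K *ₚ (L *ₚ ((A ^ᴾ n) +ₚ (-ₚ (B ^ᴾ n))))) →
                IsSeparable (powerDiff a b (suc n))
    separable (u , v , eq) = u , v , coeff≈ (≋-trans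
      (+ₚ-cong (*ₚ-congʳ u powerDiff≋) (*ₚ-congʳ v deriv-powerDiff≋)) eq)

module 𝒬-Properties {c r : Level} (F : Field c r) {l p k q : ℕ}
  (l-prime : Prime l) (l-odd : ¬ 2 ∣ l) (p-prime : Prime p) (k≥1 : k ℕ.≥ 1) (q≡pᵏ : q ≡ p ℕ.^ k)
  (l∣q+1 : l ∣ q ℕ.+ 1) (card : FieldOps.HasCardinality F (q ℕ.* q))
  (ζ : Field.Carrier F) (ζ-primitive : FieldOps.IsPrimitiveRoot F l ζ) where
  open Field F
  open FieldOps F using (InSubfield; IsSeparable; 𝒬; nat)
  open import Algebra.Properties.Semiring.Exp semiring using (_^_)
  open SemiringMult semiring using (_×_)
  open RingProperties ring using (x∙y⁻¹≈ε⇒x≈y)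
  open FieldProperties F
  open CommutativeRingProperties commutativeRing
  open FiniteField F card using (card≡^⇒×1≈0)
  open Separability F using (powerDiff-separable)
  open SetoidReasoning setoid

  p×1≈0 : p × 1# ≈ 0#
  p×1≈0 = card≡^⇒×1≈0 (k ℕ.+ k)
    (≡.trans (≡.cong₂ ℕ._*_ q≡pᵏ q≡pᵏ) (≡.sym (ℕ.^-distribˡ-+-* p k k)))

  frobenius : IsRingHomomorphism rawRing rawRing (_^ q)
  frobenius = ^-isRingHomomorphism {q} (≡.subst (λ n → ∀ x y → (x + y) ^ n ≈ x ^ n + y ^ n)
    (≡.sym q≡pᵏ) (freshmansDream-^ p-prime p×1≈0 k))

  open PolynomialMap F frobenius using (mapₚ≋⇒All; powerDiff-fixed)
  open FieldHomomorphism F frobenius using (⁻¹-swap)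

  l∣1+q : l ∣ suc q
  l∣1+q = ≡.subst (l ∣_) (ℕ.+-comm q 1) l∣q+1

  ζζ^q≈1 : ζ * ζ ^ q ≈ 1#
  ζζ^q≈1 = ∣⇒^≈1 (trans (reflexive (≡.sym (^ᶠ≡^ ζ l))) (proj₁ ζ-primitive)) l∣1+q

  ζ^q≈ζ⁻¹ : ζ ^ q ≈ ζ ⁻¹
  ζ^q≈ζ⁻¹ = ⁻¹-unique ζζ^q≈1

  ζ⁻¹^q≈ζ : (ζ ⁻¹) ^ q ≈ ζ
  ζ⁻¹^q≈ζ = ⁻¹-swap (*≈1⇒≉0 ζζ^q≈1) ζ^q≈ζ⁻¹

  ζ⁻¹-ζ≉0 : ¬ ζ ⁻¹ - ζ ≈ 0#
  ζ⁻¹-ζ≉0 ζ⁻¹-ζ≈0 = proj₂ ζ-primitive 2 (ℕ.s≤s ℕ.z≤n) (odd-prime⇒2< l-prime l-odd) (begin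
    ζ * (ζ * 1#)   ≈⟨ *-congˡ (*-identityʳ ζ) ⟩
    ζ * ζ          ≈⟨ *-congˡ (x∙y⁻¹≈ε⇒x≈y _ _ ζ⁻¹-ζ≈0) ⟨
    ζ * ζ ⁻¹       ≈⟨ ⁻¹-inverse ζ (*≈1⇒≉0 ζζ^q≈1) ⟩
    1#             ∎)

  l≉0 : ¬ nat l ≈ 0#
  l≉0 l≈0 = ∣suc⇒×1≉0 (∣⇒×1≈0 (≡.subst (p ∣_) (≡.sym q≡pᵏ) (m∣m^n p k≥1)) p×1≈0) l∣1+q
    (trans (reflexive (≡.sym (nat≡×1 l))) l≈0)

  𝒬-inSubfield : All (InSubfield q) (𝒬 l ζ)
  𝒬-inSubfield = All.map (λ {x} → trans (reflexive (^ᶠ≡^ x q)))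
    (mapₚ≋⇒All (powerDiff-fixed ζ⁻¹-ζ≉0 ζ^q≈ζ⁻¹ ζ⁻¹^q≈ζ l))

  𝒬-separable : IsSeparable (𝒬 l ζ)
  𝒬-separable = powerDiff-separable l ζ⁻¹-ζ≉0 l≉0

-- Opened only here: these names clash with the ring operations used above.
open import Data.Nat using (_+_; _*_; _^_; _≥_)
open import Data.Product using (_×_)

lemma4p3 : ∀ {c r : Level} (F : Field c r) (l p k q : ℕ) →
    Prime l → ¬ (2 ∣ l) →
    Prime p → ¬ (2 ∣ p) → k ≥ 1 → q ≡ p ^ k →
    l ∣ q + 1 →
    FieldOps.HasCardinality F (q * q) →
    (ζ : Field.Carrier F) → FieldOps.IsPrimitiveRoot F l ζ →
    All (FieldOps.InSubfield F q) (FieldOps.𝒬 F l ζ) ×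
      FieldOps.IsSeparable F (FieldOps.𝒬 F l ζ)
lemma4p3 F l p k q l-prime l-odd p-prime _ k≥1 q≡pᵏ l∣q+1 card ζ ζ-primitive =
  𝒬-inSubfield , 𝒬-separable
  where open 𝒬-Properties F l-prime l-odd p-prime k≥1 q≡pᵏ l∣q+1 card ζ ζ-primitive
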